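{- Let $n\ge 2r$ and $A=\{a_1,\dots,a_r\},B=\{b_1,\dots,b_r\}\in\binom{[n]}{r}$. Then $A$ and $B$ are cross intersecting if and only if there exist $i,j$ with $1\le i,j\le r$ such that $i+j>\max\{a_i,b_j\}$.
   Context: $[n]=\{1,\dots,n\}$; $\binom{[n]}{r}$ is the set of $r$-subsets of $[n]$ listed increasingly. Compression order: for $C,A\in\binom{[n]}{r}$, $C\le A$ iff $c_i\le a_i$ for all $i$. For $n\ge2r$, sets $A,B\in\binom{[n]}{r}$ are cross intersecting if $C\cap D\ne\emptyset$ for all $C,D\in\binom{[n]}{r}$ with $C\le A$ and $D\le B$. -}

module Defs where

open import Data.Nat using (ℕ; suc; _≤_; _<_; _+_; _⊔_)
open import Data.Fin using (Fin; toℕ)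
open import Data.Product using (Σ; _×_; ∃₂; proj₁)
open import Relation.Binary.PropositionalEquality using (_≡_)

-- Index i : Fin r stands for
-- the position (toℕ i + 1), i.e. a i is the paper's a_{i+1}.
IsRSubset : (n r : ℕ) → (Fin r → ℕ) → Set
IsRSubset n r a =
  (∀ (i j : Fin r) → toℕ i < toℕ j → a i < a j) × (∀ (i : Fin r) → 1 ≤ a i × a i ≤ n)

RSubset : ℕ → ℕ → Set
RSubset n r = Σ (Fin r → ℕ) (IsRSubset n r)

elt : ∀ {n r} → RSubset n r → Fin r → ℕ
elt = proj₁

_≼_ : ∀ {n r} → RSubset n r → RSubset n r → Set
_≼_ {r = r} C A = ∀ (i : Fin r) → elt C i ≤ elt A i

Meet : ∀ {n r} → RSubset n r → RSubset n r → Set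
Meet {r = r} C D = ∃₂ λ (i j : Fin r) → elt C i ≡ elt D j

CrossIntersecting : (n r : ℕ) → RSubset n r → RSubset n r → Set
CrossIntersecting n r A B =
  ∀ (C D : RSubset n r) → C ≼ A → D ≼ B → Meet C D

-- If i + j > max(a_i, b_j), then for C ≤ A and D ≤ B the i smallest elements of C
-- and the j smallest elements of D all lie in [1, i + j − 1], so two of them coincide.
-- Conversely, if max(a_i, b_j) ≥ i + j for all i, j, hand out 1, 2, …, 2r one at a
-- time, each to C unless it equals b_j for the next free position j of D: this greedy
-- choice keeps C ≤ A and D ≤ B, and the resulting C and D are disjoint.
module Submission where

open import Defs
open import Data.Nat using (ℕ; zero; suc; _≤_; _<_; _+_; _*_; _⊔_; z≤n; s≤s; z<s; s<s; s≤s⁻¹; s<s⁻¹)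
open import Data.Nat.Properties
open import Data.Fin using (Fin; zero; suc; toℕ; inject≤)
open import Data.Fin.Properties using (toℕ<n; toℕ-injective; toℕ-inject≤; any?)
open import Data.Vec.Functional using (Vector; []; _∷_; head; tail)
open import Data.Vec.Functional.Relation.Unary.All using (All)
open import Data.Vec.Functional.Relation.Binary.Pointwise using (Pointwise)
open import Data.Product using (∃₂; _,_; proj₁)
open import Data.Sum using (_⊎_; inj₁; inj₂)
open import Function using (_∘_)
open import Relation.Nullary using (¬_; yes; no; contradiction)
open import Relation.Binary using (tri<; tri≈; tri>)
open import Relation.Binary.PropositionalEquality
open import Function.Bundles using (_⇔_; mk⇔)

Increasing : ∀ {p} → Vector ℕ p → Set
Increasing {p} c = ∀ (i j : Fin p) → toℕ i < toℕ j → c i < c j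

Collide : ∀ {p q} → Vector ℕ p → Vector ℕ q → Set
Collide c d = ∃₂ λ i j → c i ≡ d j

record IncreasingIn (s m : ℕ) {p} (c : Vector ℕ p) : Set where
  field
    increasing : Increasing c
    above      : All (s <_) c
    atMost     : All (_≤ m) c

open IncreasingIn

increasing⇒monotone : ∀ {p} {c : Vector ℕ p} → Increasing c →
                      ∀ {i j} → toℕ i ≤ toℕ j → c i ≤ c j
increasing⇒monotone c↑ {i} {j} i≤j with m≤n⇒m<n∨m≡n i≤j
... | inj₁ i<j = <⇒≤ (c↑ i j i<j)
... | inj₂ i≡j = ≤-reflexive (cong _ (toℕ-injective i≡j))

head<tail : ∀ {p} {c : Vector ℕ (suc p)} → Increasing c → All (head c <_) (tail c)
head<tail c↑ i = c↑ zero (suc i) z<s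

head-minimal : ∀ {p} {c : Vector ℕ (suc p)} → Increasing c → All (head c ≤_) c
head-minimal c↑ zero    = ≤-refl
head-minimal c↑ (suc i) = <⇒≤ (head<tail c↑ i)

below-head⇒below-all : ∀ {p t} {c : Vector ℕ (suc p)} → Increasing c → t < head c → All (t <_) c
below-head⇒below-all c↑ t<c₀ i = <-≤-trans t<c₀ (head-minimal c↑ i)

tail-increasing : ∀ {p} {c : Vector ℕ (suc p)} → Increasing c → Increasing (tail c)
tail-increasing c↑ i j i<j = c↑ (suc i) (suc j) (s<s i<j)

∷-increasing : ∀ {p x} {c : Vector ℕ p} → All (x <_) c → Increasing c → Increasing (x ∷ c)
∷-increasing x<c c↑ zero    (suc j) _   = x<c j
∷-increasing x<c c↑ (suc i) (suc j) i<j = c↑ i j (s<s⁻¹ i<j)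

tail-increasingIn : ∀ {p s m} {c : Vector ℕ (suc p)} →
                    IncreasingIn s m c → IncreasingIn (head c) m (tail c)
tail-increasingIn c∈ = record
  { increasing = tail-increasing (increasing c∈)
  ; above      = head<tail (increasing c∈)
  ; atMost     = atMost c∈ ∘ suc
  }

with-above : ∀ {p s t m} {c : Vector ℕ p} → All (t <_) c → IncreasingIn s m c → IncreasingIn t m c
with-above t<c c∈ = record { increasing = increasing c∈ ; above = t<c ; atMost = atMost c∈ }

collide-or-count : ∀ {p q s m} {c : Vector ℕ p} {d : Vector ℕ q} → s ≤ m →
                   IncreasingIn s m c → IncreasingIn s m d → Collide c d ⊎ p + q + s ≤ m
skip-head-c      : ∀ {p q s m} {c : Vector ℕ (suc p)} {d : Vector ℕ q} →
                   IncreasingIn s m c → IncreasingIn s m d → All (head c <_) d →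
                   Collide c d ⊎ suc p + q + s ≤ m
skip-head-d      : ∀ {p q s m} {c : Vector ℕ p} {d : Vector ℕ (suc q)} →
                   IncreasingIn s m c → IncreasingIn s m d → All (head d <_) c →
                   Collide c d ⊎ p + suc q + s ≤ m

collide-or-count {zero}  {zero}  s≤m _  _  = inj₂ s≤m
collide-or-count {suc p} {zero}  _   c∈ d∈ = skip-head-c c∈ d∈ λ ()
collide-or-count {zero}  {suc q} _   c∈ d∈ = skip-head-d c∈ d∈ λ ()
collide-or-count {suc p} {suc q} {c = c} {d} _ c∈ d∈ with <-cmp (head c) (head d)
... | tri< c₀<d₀ _ _ = skip-head-c c∈ d∈ (below-head⇒below-all (increasing d∈) c₀<d₀)
... | tri≈ _ c₀≡d₀ _ = inj₁ (zero , zero , c₀≡d₀)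
... | tri> _ _ d₀<c₀ = skip-head-d c∈ d∈ (below-head⇒below-all (increasing c∈) d₀<c₀)

skip-head-c {p} {q} c∈ d∈ c₀<d
  with collide-or-count (atMost c∈ zero) (tail-increasingIn c∈) (with-above c₀<d d∈)
... | inj₁ (i , j , cᵢ≡dⱼ) = inj₁ (suc i , j , cᵢ≡dⱼ)
... | inj₂ count          = inj₂ (≤-trans (+-monoʳ-< (p + q) (above c∈ zero)) count)

skip-head-d {p} {q} {s} {m} c∈ d∈ d₀<c
  with collide-or-count (atMost d∈ zero) (with-above d₀<c c∈) (tail-increasingIn d∈)
... | inj₁ (i , j , cᵢ≡dⱼ) = inj₁ (i , suc j , cᵢ≡dⱼ)
... | inj₂ count          =
  inj₂ (subst (_≤ m) (cong (_+ s) (sym (+-suc p q)))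
              (≤-trans (+-monoʳ-< (p + q) (above d∈ zero)) count))

-- The condition max(a_i, b_j) ≥ i + j, shifted by the s values already handed out.
Spread : ℕ → ∀ {p q} → Vector ℕ p → Vector ℕ q → Set
Spread s a b = ∀ i j → s + (toℕ i + 1) + (toℕ j + 1) ≤ a i ⊔ b j

spread-tailˡ : ∀ {s p q} {a : Vector ℕ (suc p)} {b : Vector ℕ q} → Spread s a b → Spread (suc s) (tail a) b
spread-tailˡ {s} {a = a} {b} spread i j =
  subst (λ x → x + (toℕ j + 1) ≤ a (suc i) ⊔ b j) (+-suc s (toℕ i + 1)) (spread (suc i) j)

spread-tailʳ : ∀ {s p q} {a : Vector ℕ p} {b : Vector ℕ (suc q)} → Spread s a b → Spread (suc s) a (tail b)
spread-tailʳ {s} {a = a} {b} spread i j =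
  subst (_≤ a i ⊔ b (suc j)) (+-suc (s + (toℕ i + 1)) (toℕ j + 1)) (spread i (suc j))

-- The outcome of handing out s + 1, …, s + p + q.
record DisjointCompressions (s : ℕ) {p q} (a : Vector ℕ p) (b : Vector ℕ q) : Set where
  field
    c        : Vector ℕ p
    d        : Vector ℕ q
    c≤a      : Pointwise _≤_ c a
    d≤b      : Pointwise _≤_ d b
    c∈       : IncreasingIn s (p + q + s) c
    d∈       : IncreasingIn s (p + q + s) d
    disjoint : ¬ Collide c d

lower-above : ∀ {p s m} {c : Vector ℕ p} → IncreasingIn (suc s) m c → IncreasingIn s m c
lower-above {s = s} c∈ = with-above (λ i → <-trans (n<1+n s) (above c∈ i)) c∈

∷-increasingIn : ∀ {p s m} {c : Vector ℕ p} → suc s ≤ m → IncreasingIn (suc s) m c →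
                 IncreasingIn s m (suc s ∷ c)
∷-increasingIn s<m c∈ = record
  { increasing = ∷-increasing (above c∈) (increasing c∈)
  ; above      = λ { zero → ≤-refl ; (suc i) → <-trans (n<1+n _) (above c∈ i) }
  ; atMost     = λ { zero → s<m ; (suc i) → atMost c∈ i }
  }

⊔-bound-left : ∀ {m n k} → k ≤ m ⊔ n → n < k → k ≤ m
⊔-bound-left {m} {n} k≤m⊔n n<k with ⊔-sel m n
... | inj₁ m⊔n≡m = subst (_ ≤_) m⊔n≡m k≤m⊔n
... | inj₂ m⊔n≡n = contradiction (subst (_ ≤_) m⊔n≡n k≤m⊔n) (<⇒≱ n<k)

s+1+1≡2+s : ∀ s → s + 1 + 1 ≡ 2 + s
s+1+1≡2+s s = trans (+-comm (s + 1) 1) (cong suc (+-comm s 1))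

disjointCompressions : ∀ {p q s} {a : Vector ℕ p} {b : Vector ℕ q} → Increasing a → Increasing b →
                       All (s <_) a → All (s <_) b → Spread s a b → DisjointCompressions s a b
give-head-to-c       : ∀ {p q s} {a : Vector ℕ (suc p)} {b : Vector ℕ q} → Increasing a → Increasing b →
                       All (s <_) a → All (suc s <_) b → Spread s a b → DisjointCompressions s a b
give-head-to-d       : ∀ {p q s} {a : Vector ℕ p} {b : Vector ℕ (suc q)} → Increasing a → Increasing b →
                       All (suc s <_) a → All (s <_) b → Spread s a b → DisjointCompressions s a b

disjointCompressions {zero} {zero} _ _ _ _ _ = record
  { c = [] ; d = [] ; c≤a = λ () ; d≤b = λ () ; disjoint = λ ()
  ; c∈ = record { increasing = λ () ; above = λ () ; atMost = λ () }
  ; d∈ = record { increasing = λ () ; above = λ () ; atMost = λ () }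
  }
disjointCompressions {suc p} {zero}  a↑ b↑ s<a _   spread = give-head-to-c a↑ b↑ s<a (λ ()) spread
disjointCompressions {zero}  {suc q} a↑ b↑ _   s<b spread = give-head-to-d a↑ b↑ (λ ()) s<b spread
disjointCompressions {suc p} {suc q} {s} {a} {b} a↑ b↑ s<a s<b spread with suc s <? head b
... | yes s+1<b₀ = give-head-to-c a↑ b↑ s<a (below-head⇒below-all b↑ s+1<b₀) spread
... | no  s+1≮b₀ = give-head-to-d a↑ b↑ (below-head⇒below-all a↑ s+1<a₀) s<b spread
  where
  s+1<a₀ : suc s < head a
  s+1<a₀ = ⊔-bound-left (subst (_≤ head a ⊔ head b) (s+1+1≡2+s s) (spread zero zero)) (s≤s (≮⇒≥ s+1≮b₀))

give-head-to-c {p} {q} {s} {a} {b} a↑ b↑ s<a s+1<b spread = record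
  { c        = suc s ∷ c
  ; d        = d
  ; c≤a      = λ { zero → s<a zero ; (suc i) → c≤a i }
  ; d≤b      = d≤b
  ; c∈       = reindex (∷-increasingIn (m≤n+m (suc s) (p + q)) c∈)
  ; d∈       = reindex (lower-above d∈)
  ; disjoint = λ { (zero , j , e) → <-irrefl e (above d∈ j) ; (suc i , j , e) → disjoint (i , j , e) }
  }
  where
  open DisjointCompressions (disjointCompressions (tail-increasing a↑) b↑
    (λ i → ≤-<-trans (s<a zero) (head<tail a↑ i)) s+1<b (spread-tailˡ {s} {a = a} {b} spread))
  reindex : ∀ {t x} {v : Vector ℕ x} → IncreasingIn t (p + q + suc s) v → IncreasingIn t (suc p + q + s) v
  reindex {t} {v = v} = subst (λ m → IncreasingIn t m v) (+-suc (p + q) s)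

give-head-to-d {p} {q} {s} {a} {b} a↑ b↑ s+1<a s<b spread = record
  { c        = c
  ; d        = suc s ∷ d
  ; c≤a      = c≤a
  ; d≤b      = λ { zero → s<b zero ; (suc j) → d≤b j }
  ; c∈       = reindex (lower-above c∈)
  ; d∈       = reindex (∷-increasingIn (m≤n+m (suc s) (p + q)) d∈)
  ; disjoint = λ { (i , zero , e) → <-irrefl (sym e) (above c∈ i) ; (i , suc j , e) → disjoint (i , j , e) }
  }
  where
  open DisjointCompressions (disjointCompressions a↑ (tail-increasing b↑)
    s+1<a (λ j → ≤-<-trans (s<b zero) (head<tail b↑ j)) (spread-tailʳ {s} {a = a} {b} spread))
  reindex : ∀ {t x} {v : Vector ℕ x} → IncreasingIn t (p + q + suc s) v → IncreasingIn t (p + suc q + s) v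
  reindex {t} {v = v} =
    subst (λ m → IncreasingIn t m v) (trans (+-suc (p + q) s) (cong (_+ s) (sym (+-suc p q))))

prefix : ∀ {r} → Vector ℕ r → (i : Fin r) → Vector ℕ (suc (toℕ i))
prefix c i k = c (inject≤ k (toℕ<n i))

prefix-increasingIn : ∀ {r s m} {c : Vector ℕ r} → Increasing c → All (s <_) c →
                      (i : Fin r) → c i ≤ m → IncreasingIn s m (prefix c i)
prefix-increasingIn c↑ s<c i cᵢ≤m = record
  { increasing = λ k l k<l → c↑ _ _ (subst₂ _<_ (sym (toℕ-inject≤ k _)) (sym (toℕ-inject≤ l _)) k<l)
  ; above      = λ k → s<c _
  ; atMost     = λ k → ≤-trans (increasing⇒monotone c↑ (k≤i k)) cᵢ≤m
  }
  where
  k≤i : ∀ k → toℕ (inject≤ k (toℕ<n i)) ≤ toℕ i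
  k≤i k = subst (_≤ toℕ i) (sym (toℕ-inject≤ k _)) (s≤s⁻¹ (toℕ<n k))

MaxBelowIndexSum : ∀ {r} → Vector ℕ r → Vector ℕ r → Set
MaxBelowIndexSum {r} a b = ∃₂ λ (i j : Fin r) → a i ⊔ b j < (toℕ i + 1) + (toℕ j + 1)

suc+suc≡+1++1 : ∀ x y → suc x + suc y + 0 ≡ (x + 1) + (y + 1)
suc+suc≡+1++1 x y = trans (+-identityʳ _) (cong₂ _+_ (+-comm 1 x) (+-comm 1 y))

maxBelowIndexSum⇒crossIntersecting : ∀ {n r} (A B : RSubset n r) →
                                     MaxBelowIndexSum (elt A) (elt B) → CrossIntersecting n r A B
maxBelowIndexSum⇒crossIntersecting (a , _) (b , _) (i , j , max<)
                                   (c , c↑ , c-range) (d , d↑ , d-range) c≤a d≤b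
  with collide-or-count z≤n
         (prefix-increasingIn c↑ (proj₁ ∘ c-range) i (≤-trans (c≤a i) (m≤m⊔n (a i) (b j))))
         (prefix-increasingIn d↑ (proj₁ ∘ d-range) j (≤-trans (d≤b j) (m≤n⊔m (a i) (b j))))
... | inj₁ (k , l , cₖ≡dₗ) = inject≤ k _ , inject≤ l _ , cₖ≡dₗ
... | inj₂ count          =
  contradiction (subst (_≤ a i ⊔ b j) (suc+suc≡+1++1 (toℕ i) (toℕ j)) count) (<⇒≱ max<)

increasingIn⇒isRSubset : ∀ {n r m} {c : Vector ℕ r} → m ≤ n → IncreasingIn 0 m c → IsRSubset n r c
increasingIn⇒isRSubset m≤n c∈ = increasing c∈ , λ i → above c∈ i , ≤-trans (atMost c∈ i) m≤n

crossIntersecting⇒maxBelowIndexSum : ∀ {n r} → 2 * r ≤ n → (A B : RSubset n r) →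
                                     CrossIntersecting n r A B → MaxBelowIndexSum (elt A) (elt B)
crossIntersecting⇒maxBelowIndexSum {n} {r} 2r≤n (a , a↑ , a-range) (b , b↑ , b-range) cross
  with any? (λ i → any? (λ j → a i ⊔ b j <? (toℕ i + 1) + (toℕ j + 1)))
... | yes found = found
... | no  none  = contradiction (cross (c , isRSubset c∈) (d , isRSubset d∈) c≤a d≤b) disjoint
  where
  open DisjointCompressions
    (disjointCompressions a↑ b↑ (proj₁ ∘ a-range) (proj₁ ∘ b-range) λ i j → ≮⇒≥ λ lt → none (i , j , lt))
  isRSubset : ∀ {v} → IncreasingIn 0 (r + r + 0) v → IsRSubset n r v
  isRSubset = increasingIn⇒isRSubset (subst (_≤ n) (sym (+-assoc r r 0)) 2r≤n)

lemma10 : (n r : ℕ) → 2 * r ≤ n → (A B : RSubset n r) →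
    CrossIntersecting n r A B ⇔
      (∃₂ λ (i j : Fin r) → elt A i ⊔ elt B j < (toℕ i + 1) + (toℕ j + 1))
lemma10 n r 2r≤n A B =
  mk⇔ (crossIntersecting⇒maxBelowIndexSum 2r≤n A B) (maxBelowIndexSum⇒crossIntersecting A B)
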